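{- Let $f_0:\{1,2,\dots\}\to\mathbb{C}$ be an arithmetic function, with iterated invert transforms $f_m$ and numbers $c_m(n,k)$ as in the context. For each integer $m>1$ and each $n\ge1$, we have the matrix identity $C_m(n)=C_{m-1}(n)\cdot L_n$; equivalently, for all $1\le k\le n$, \[ c_m(n,k)=\sum_{i=k}^{n}\binom{i-1}{k-1}c_{m-1}(n,i). \]
   Context: For $m\ge1$, $f_m$ is the $m$th invert transform of $f_0$, defined recursively by $f_m(0)=1$ and $f_m(n)=\sum_{i=1}^{n} f_{m-1}(i)\,f_m(n-i)$ for $n\ge1$; equivalently, $1+\sum_{n\ge1}f_m(n)x^n=\bigl(1-\sum_{n\ge1}f_{m-1}(n)x^n\bigr)^{ -1}$. For integers $m\ge1$ and $0\le k\le n$, $c_m(n,k)$ is defined by $c_m(0,0)=1$, $c_m(n,0)=0$ for $n\ge1$, and $c_m(n,k)=\sum_{i=1}^{n-k+1} f_{m-1}(i)\,c_m(n-i,k-1)$ for $1\le k\le n$. $C_m(n)$ denotes the $n\times n$ lower triangular matrix whose $(r,s)$ entry is $c_m(r,s)$ for $1\le s\le r\le n$ (and $0$ for $s>r$), and $L_n$ is the $n\times n$ lower triangular Pascal matrix, whose $(r,s)$ entry is $\binom{r-1}{s-1}$. -}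

module Defs where

open import Level using (Level)
open import Algebra.Bundles using (CommutativeRing)
open import Data.Nat using (ℕ; zero; suc; _∸_) renaming (_+_ to _+ℕ_)
open import Data.Nat.Combinatorics using (_C_)
open import Data.Fin using (Fin; toℕ)
import Data.Fin
open import Data.Vec using (Vec; []; _∷_; lookup; head)

module InvertTransform {a ℓ : Level} (R : CommutativeRing a ℓ) where
  open CommutativeRing R
  open import Algebra.Definitions.RawMonoid +-rawMonoid using (_×_)

  sumBelow : ℕ → (ℕ → Carrier) → Carrier
  sumBelow zero    h = 0#
  sumBelow (suc n) h = sumBelow n h + h n

  -- Σ_{i = a}^{b} h i   (empty, i.e. 0#, when b < a)
  sumFromTo : ℕ → ℕ → (ℕ → Carrier) → Carrier
  sumFromTo a b h = sumBelow (suc b ∸ a) (λ j → h (a +ℕ j))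

  sumFin : (n : ℕ) → (Fin n → Carrier) → Carrier
  sumFin zero    h = 0#
  sumFin (suc n) h = h Data.Fin.zero + sumFin n (λ j → h (Data.Fin.suc j))


  -- invVec g n = (G n , G (n-1) , … , G 0) where G is the invert transform of g:
  -- G 0 = 1, G n = Σ_{i=1}^{n} g i * G (n - i).
  invVec : (ℕ → Carrier) → (n : ℕ) → Vec Carrier (suc n)
  invVec g zero    = 1# ∷ []
  invVec g (suc n) = new ∷ prev
    where
      prev : Vec Carrier (suc n)
      prev = invVec g n
      -- lookup prev j = G (n - j), so g (j+1) * G (n+1-(j+1))
      new : Carrier
      new = sumFin (suc n) (λ j → g (suc (toℕ j)) * lookup prev j)

  invert : (ℕ → Carrier) → ℕ → Carrier
  invert g n = head (invVec g n)

  -- f m = m-th invert transform of f0 (value f0 0 is irrelevant, f0 is on {1,2,…})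
  f : (ℕ → Carrier) → ℕ → ℕ → Carrier
  f f0 zero    = f0
  f f0 (suc m) = invert (f f0 m)

  cc : (ℕ → Carrier) → ℕ → ℕ → Carrier
  cc g zero    zero    = 1#
  cc g (suc n) zero    = 0#
  cc g n       (suc k) = sumFromTo 1 (n ∸ k) (λ i → g i * cc g (n ∸ i) k)

  -- c_m(n,k), meaningful for m ≥ 1
  c : (ℕ → Carrier) → ℕ → ℕ → ℕ → Carrier
  c f0 m = cc (f f0 (m ∸ 1))

  binomR : ℕ → ℕ → Carrier
  binomR a b = (a C b) × 1#

-- Let convolve g S n = Σ_{j<n} g(j+1) S(n-1-j), the coefficient of xⁿ in
-- (Σ_{i≥1} g i xⁱ)·(Σ_p S p xᵖ). Then cc g · (k+1) = convolve g (cc g · k), and the invert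
-- transform G of g satisfies G(j+1) = g(j+1) + Σ_{l<j} g(l+1) G(j-l), i.e. G = 1 + g·G, whence
-- convolve G S = convolve g S + convolve g (convolve G S). So the columns A k = cc G · k obey
-- A (k+1) = convolve g (A k) + convolve g (A (k+1)). By Pascal's rule the sums
-- Σ_i C(i-1,k-1) cc g · i obey the same recursion, and strong induction on n identifies the two.
module Submission where

open import Defs
open import Level using (Level)
open import Algebra.Bundles using (CommutativeRing)
open import Data.Nat as ℕ using (ℕ; zero; suc; _∸_; _≤_; _<_; z≤n; s≤s)
import Data.Nat.Properties as ℕₚ
open import Data.Nat.Induction using (<-rec)
open import Data.Nat.Combinatorics using (_C_; nCk+nC[k+1]≡[n+1]C[k+1]; k>n⇒nCk≡0)
open import Data.Fin as Fin using (Fin; toℕ)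
open import Data.Vec using (lookup)
open import Data.Sum using (inj₁; inj₂)
open import Data.Empty using (⊥-elim)
open import Relation.Binary.PropositionalEquality as ≡ using (_≡_)
import Algebra.Properties.CommutativeSemigroup as CommSemigroupProperties
import Algebra.Properties.Monoid.Mult as MultProperties
import Relation.Binary.Reasoning.Setoid as SetoidReasoning

m∸[1+n]≤o⇒m∸[1+o]≤n : ∀ m n o → m ∸ suc n ≤ o → m ∸ suc o ≤ n
m∸[1+n]≤o⇒m∸[1+o]≤n m n o le =
  ℕₚ.m≤n+o⇒m∸n≤o m (suc o) (ℕₚ.≤-trans m≤1+n+o (ℕₚ.≤-reflexive (≡.cong suc (ℕₚ.+-comm n o))))
  where
  m≤1+n+o : m ≤ suc (n ℕ.+ o)
  m≤1+n+o = ℕₚ.≤-trans (ℕₚ.m≤n+m∸n m (suc n)) (ℕₚ.+-monoʳ-≤ (suc n) le)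

m<n⇒1+[n∸[1+m]]≡n∸m : ∀ {m n} → m < n → suc (n ∸ suc m) ≡ n ∸ m
m<n⇒1+[n∸[1+m]]≡n∸m {m} {suc n} (s≤s m≤n) = ≡.sym (ℕₚ.+-∸-assoc 1 m≤n)

∸-telescope : ∀ o {m n} → m < n → o ∸ suc m ∸ suc (n ∸ suc m) ≡ o ∸ suc n
∸-telescope o {m} {n} m<n = ≡.trans (ℕₚ.∸-+-assoc o (suc m) (suc (n ∸ suc m)))
  (≡.cong (λ x → o ∸ suc x)
    (≡.trans (≡.cong (m ℕ.+_) (m<n⇒1+[n∸[1+m]]≡n∸m m<n)) (ℕₚ.m+[n∸m]≡n (ℕₚ.<⇒≤ m<n))))

m<n⇒n∸[1+m]<n : ∀ {m n} → m < n → n ∸ suc m < n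
m<n⇒n∸[1+m]<n {m} {suc n} _ = s≤s (ℕₚ.m∸n≤m n m)

module _ {a ℓ : Level} (R : CommutativeRing a ℓ) where
  open CommutativeRing R hiding (zero)
  open InvertTransform R
  open SetoidReasoning setoid
  open CommSemigroupProperties +-commutativeSemigroup using (interchange)
  open MultProperties +-monoid using (×-homo-+)

  sumBelow-cong : ∀ n {F G : ℕ → Carrier} → (∀ i → i < n → F i ≈ G i) →
                  sumBelow n F ≈ sumBelow n G
  sumBelow-cong zero    eq = refl
  sumBelow-cong (suc n) eq =
    +-cong (sumBelow-cong n (λ i i<n → eq i (ℕₚ.m<n⇒m<1+n i<n))) (eq n ℕₚ.≤-refl)

  sumBelow-suc : ∀ n F → sumBelow (suc n) F ≈ F 0 + sumBelow n (λ i → F (suc i))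
  sumBelow-suc zero    F = +-comm 0# (F 0)
  sumBelow-suc (suc n) F = trans (+-cong (sumBelow-suc n F) refl) (+-assoc _ _ _)

  sumBelow-+ : ∀ n F G → sumBelow n (λ i → F i + G i) ≈ sumBelow n F + sumBelow n G
  sumBelow-+ zero    F G = sym (+-identityʳ 0#)
  sumBelow-+ (suc n) F G = trans (+-cong (sumBelow-+ n F G) refl) (interchange _ _ _ _)

  sumBelow-zero : ∀ n F → (∀ i → i < n → F i ≈ 0#) → sumBelow n F ≈ 0#
  sumBelow-zero zero    F z = refl
  sumBelow-zero (suc n) F z =
    trans (+-cong (sumBelow-zero n F (λ i i<n → z i (ℕₚ.m<n⇒m<1+n i<n))) (z n ℕₚ.≤-refl))
          (+-identityʳ 0#)

  *-distribˡ-sumBelow : ∀ n x F → x * sumBelow n F ≈ sumBelow n (λ i → x * F i)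
  *-distribˡ-sumBelow zero    x F = zeroʳ x
  *-distribˡ-sumBelow (suc n) x F = trans (distribˡ x _ _) (+-cong (*-distribˡ-sumBelow n x F) refl)

  *-distribʳ-sumBelow : ∀ n x F → sumBelow n F * x ≈ sumBelow n (λ i → F i * x)
  *-distribʳ-sumBelow zero    x F = zeroˡ x
  *-distribʳ-sumBelow (suc n) x F = trans (distribʳ x _ _) (+-cong (*-distribʳ-sumBelow n x F) refl)

  sumBelow-comm : ∀ m n (F : ℕ → ℕ → Carrier) →
    sumBelow m (λ i → sumBelow n (F i)) ≈ sumBelow n (λ j → sumBelow m (λ i → F i j))
  sumBelow-comm zero    n F = sym (sumBelow-zero n _ (λ _ _ → refl))
  sumBelow-comm (suc m) n F = trans (+-cong (sumBelow-comm m n F) refl) (sym (sumBelow-+ n _ _))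

  sumBelow-triangle : ∀ n (F : ℕ → ℕ → Carrier) →
    sumBelow n (λ j → sumBelow j (λ l → F l (j ∸ suc l))) ≈
    sumBelow n (λ l → sumBelow (n ∸ suc l) (F l))
  sumBelow-triangle zero    F = refl
  sumBelow-triangle (suc n) F = begin
    sumBelow (suc n) (λ j → sumBelow j (λ l → F l (j ∸ suc l)))
      ≈⟨ trans (sumBelow-suc n _) (+-identityˡ _) ⟩
    sumBelow n (λ j → sumBelow (suc j) (λ l → F l (j ∸ l)))
      ≈⟨ sumBelow-cong n (λ j _ → sumBelow-suc j _) ⟩
    sumBelow n (λ j → F 0 j + sumBelow j (λ l → F (suc l) (j ∸ suc l)))
      ≈⟨ sumBelow-+ n _ _ ⟩
    sumBelow n (F 0) + sumBelow n (λ j → sumBelow j (λ l → F (suc l) (j ∸ suc l)))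
      ≈⟨ +-cong refl (sumBelow-triangle n (λ l → F (suc l))) ⟩
    sumBelow n (F 0) + sumBelow n (λ l → sumBelow (n ∸ suc l) (F (suc l)))
      ≈⟨ sym (sumBelow-suc n _) ⟩
    sumBelow (suc n) (λ l → sumBelow (suc n ∸ suc l) (F l)) ∎

  sumBelow-truncate : ∀ m n F → m ≤ n → (∀ j → m ≤ j → j < n → F j ≈ 0#) →
                      sumBelow n F ≈ sumBelow m F
  sumBelow-truncate m zero    F z≤n z = refl
  sumBelow-truncate m (suc n) F m≤1+n z with ℕₚ.m≤n⇒m<n∨m≡n m≤1+n
  ... | inj₂ ≡.refl      = refl
  ... | inj₁ (s≤s m≤n) = trans
    (+-cong (sumBelow-truncate m n F m≤n (λ j m≤j j<n → z j m≤j (ℕₚ.m<n⇒m<1+n j<n)))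
            (z n m≤n ℕₚ.≤-refl))
    (+-identityʳ _)

  sumBelow-split : ∀ m n F → sumBelow (m ℕ.+ n) F ≈ sumBelow m F + sumBelow n (λ j → F (m ℕ.+ j))
  sumBelow-split m zero    F rewrite ℕₚ.+-identityʳ m = sym (+-identityʳ _)
  sumBelow-split m (suc n) F rewrite ℕₚ.+-suc m n =
    trans (+-cong (sumBelow-split m n F) refl) (+-assoc _ _ _)

  sumFin-cong : ∀ n {F G : Fin n → Carrier} → (∀ j → F j ≈ G j) → sumFin n F ≈ sumFin n G
  sumFin-cong zero    eq = refl
  sumFin-cong (suc n) eq = +-cong (eq Fin.zero) (sumFin-cong n (λ j → eq (Fin.suc j)))

  sumFin-toℕ : ∀ n F → sumFin n (λ j → F (toℕ j)) ≈ sumBelow n F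
  sumFin-toℕ zero    F = refl
  sumFin-toℕ (suc n) F = trans (+-cong refl (sumFin-toℕ n (λ i → F (suc i)))) (sym (sumBelow-suc n F))

  binomR-pascal : ∀ n k → binomR (suc n) (suc k) ≈ binomR n k + binomR n (suc k)
  binomR-pascal n k = trans
    (reflexive (≡.cong (λ x → x × 1#) (≡.sym (nCk+nC[k+1]≡[n+1]C[k+1] n k))))
    (×-homo-+ 1# (n C k) (n C suc k))
    where open import Algebra.Definitions.RawMonoid +-rawMonoid using (_×_)

  binomR-vanishes : ∀ {n k} → n < k → binomR n k ≈ 0#
  binomR-vanishes n<k rewrite k>n⇒nCk≡0 n<k = refl

  sumBelow-binomR-shift : ∀ k n (F : ℕ → Carrier) →
    sumBelow (k ℕ.+ n) (λ i → binomR i k * F i) ≈ sumBelow n (λ j → binomR (k ℕ.+ j) k * F (k ℕ.+ j))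
  sumBelow-binomR-shift k n F = begin
    sumBelow (k ℕ.+ n) (λ i → binomR i k * F i)
      ≈⟨ sumBelow-split k n _ ⟩
    sumBelow k (λ i → binomR i k * F i) + sumBelow n (λ j → binomR (k ℕ.+ j) k * F (k ℕ.+ j))
      ≈⟨ +-cong (sumBelow-zero k _ (λ i i<k → trans (*-cong (binomR-vanishes i<k) refl) (zeroˡ _))) refl ⟩
    0# + sumBelow n (λ j → binomR (k ℕ.+ j) k * F (k ℕ.+ j))
      ≈⟨ +-identityˡ _ ⟩
    sumBelow n (λ j → binomR (k ℕ.+ j) k * F (k ℕ.+ j)) ∎

  convolve : (ℕ → Carrier) → (ℕ → Carrier) → ℕ → Carrier
  convolve g S n = sumBelow n (λ j → g (suc j) * S (n ∸ suc j))

  convolve-cong : ∀ g {S S′} n → (∀ p → p < n → S p ≈ S′ p) → convolve g S n ≈ convolve g S′ n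
  convolve-cong g n eq = sumBelow-cong n (λ j j<n → *-cong refl (eq _ (m<n⇒n∸[1+m]<n j<n)))

  sumBelow-convolve : ∀ g m (w : ℕ → Carrier) (S : ℕ → ℕ → Carrier) n →
    sumBelow m (λ i → w i * convolve g (S i) n) ≈ convolve g (λ p → sumBelow m (λ i → w i * S i p)) n
  sumBelow-convolve g m w S n = begin
    sumBelow m (λ i → w i * convolve g (S i) n)
      ≈⟨ sumBelow-cong m (λ i _ → *-distribˡ-sumBelow n _ _) ⟩
    sumBelow m (λ i → sumBelow n (λ j → w i * (g (suc j) * S i (n ∸ suc j))))
      ≈⟨ sumBelow-comm m n _ ⟩
    sumBelow n (λ j → sumBelow m (λ i → w i * (g (suc j) * S i (n ∸ suc j))))
      ≈⟨ sumBelow-cong n (λ j _ → trans (sumBelow-cong m (λ i _ → x*[y*z]≈y*[x*z] _ _ _))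
                                         (sym (*-distribˡ-sumBelow m _ _))) ⟩
    convolve g (λ p → sumBelow m (λ i → w i * S i p)) n ∎
    where
    x*[y*z]≈y*[x*z] : ∀ x y z → x * (y * z) ≈ y * (x * z)
    x*[y*z]≈y*[x*z] x y z =
      trans (sym (*-assoc x y z)) (trans (*-cong (*-comm x y) refl) (*-assoc y x z))

  cc-vanishes : ∀ g n k → n ≤ k → cc g n (suc k) ≈ 0#
  cc-vanishes g zero    k n≤k rewrite ℕₚ.m≤n⇒m∸n≡0 n≤k = refl
  cc-vanishes g (suc n) k n≤k rewrite ℕₚ.m≤n⇒m∸n≡0 n≤k = refl

  convolve-cc-truncate : ∀ g n k →
    sumBelow (n ∸ k) (λ j → g (suc j) * cc g (n ∸ suc j) k) ≈ convolve g (λ p → cc g p k) n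
  convolve-cc-truncate g n k = sym (sumBelow-truncate (n ∸ k) n _ (ℕₚ.m∸n≤m n k) (vanishing k))
    where
    vanishing : ∀ k j → n ∸ k ≤ j → j < n → g (suc j) * cc g (n ∸ suc j) k ≈ 0#
    vanishing zero     j n≤j j<n = ⊥-elim (ℕₚ.<⇒≱ j<n n≤j)
    vanishing (suc k) j le  _   =
      trans (*-cong refl (cc-vanishes g _ k (m∸[1+n]≤o⇒m∸[1+o]≤n n k j le))) (zeroʳ _)

  -- cc g n (suc k) only unfolds once n is a constructor.
  cc-suc : ∀ g n k → cc g n (suc k) ≈ convolve g (λ p → cc g p k) n
  cc-suc g zero    k = convolve-cc-truncate g zero k
  cc-suc g (suc n) k = convolve-cc-truncate g (suc n) k

  lookup-invVec : ∀ g n (j : Fin (suc n)) → lookup (invVec g n) j ≡ invert g (n ∸ toℕ j)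
  lookup-invVec g zero    Fin.zero    = ≡.refl
  lookup-invVec g (suc n) Fin.zero    = ≡.refl
  lookup-invVec g (suc n) (Fin.suc j) = lookup-invVec g n j

  invert-suc : ∀ g n → invert g (suc n) ≈ convolve g (invert g) (suc n)
  invert-suc g n = trans
    (sumFin-cong (suc n) {G = λ j → g (suc (toℕ j)) * invert g (n ∸ toℕ j)}
                 (λ j → *-cong refl (reflexive (lookup-invVec g n j))))
    (sumFin-toℕ (suc n) (λ j → g (suc j) * invert g (n ∸ j)))

  convolve-invert : ∀ g S n →
    convolve (invert g) S n ≈ convolve g S n + convolve g (convolve (invert g) S) n
  convolve-invert g S n = begin
    convolve G S n
      ≈⟨ sumBelow-cong n (λ j _ → *-cong (invert-suc g j) refl) ⟩
    sumBelow n (λ j → (sumBelow j (λ l → g (suc l) * G (j ∸ l)) + g (suc j) * G (j ∸ j)) * S (n ∸ suc j))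
      ≈⟨ sumBelow-cong n (λ j _ → trans (distribʳ _ _ _)
                                        (+-cong (*-distribʳ-sumBelow j _ _) (*-cong (g*G0 j) refl))) ⟩
    sumBelow n (λ j → sumBelow j (λ l → g (suc l) * G (j ∸ l) * S (n ∸ suc j)) + g (suc j) * S (n ∸ suc j))
      ≈⟨ trans (sumBelow-+ n _ _) (+-comm _ _) ⟩
    convolve g S n + sumBelow n (λ j → sumBelow j (λ l → g (suc l) * G (j ∸ l) * S (n ∸ suc j)))
      ≈⟨ +-cong refl (sumBelow-cong n (λ j _ → sumBelow-cong j (λ l → reindex j l))) ⟩
    convolve g S n + sumBelow n (λ j → sumBelow j (λ l → term l (j ∸ suc l)))
      ≈⟨ +-cong refl (sumBelow-triangle n term) ⟩
    convolve g S n + sumBelow n (λ l → sumBelow (n ∸ suc l) (term l))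
      ≈⟨ +-cong refl (sumBelow-cong n (λ l _ → sym (*-distribˡ-sumBelow (n ∸ suc l) _ _))) ⟩
    convolve g S n + convolve g (convolve G S) n ∎
    where
    G : ℕ → Carrier
    G = invert g
    g*G0 : ∀ j → g (suc j) * G (j ∸ j) ≈ g (suc j)
    g*G0 j rewrite ℕₚ.n∸n≡0 j = *-identityʳ _
    term : ℕ → ℕ → Carrier
    term l d = g (suc l) * (G (suc d) * S (n ∸ suc l ∸ suc d))
    reindex : ∀ j l → l < j → g (suc l) * G (j ∸ l) * S (n ∸ suc j) ≈ term l (j ∸ suc l)
    reindex j l l<j = trans (*-assoc _ _ _)
      (*-cong refl (*-cong (reflexive (≡.cong G (≡.sym (m<n⇒1+[n∸[1+m]]≡n∸m l<j))))
                           (reflexive (≡.cong S (≡.sym (∸-telescope n l<j))))))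

  cc-invert-suc : ∀ g n k →
    cc (invert g) n (suc k) ≈
    convolve g (λ p → cc (invert g) p k) n + convolve g (λ p → cc (invert g) p (suc k)) n
  cc-invert-suc g n k = begin
    cc G n (suc k)
      ≈⟨ cc-suc G n k ⟩
    convolve G (λ p → cc G p k) n
      ≈⟨ convolve-invert g (λ p → cc G p k) n ⟩
    convolve g (λ p → cc G p k) n + convolve g (convolve G (λ p → cc G p k)) n
      ≈⟨ +-cong refl (convolve-cong g n (λ p _ → sym (cc-suc G p k))) ⟩
    convolve g (λ p → cc G p k) n + convolve g (λ p → cc G p (suc k)) n ∎
    where
    G : ℕ → Carrier
    G = invert g

  -- Σ_{i=1}^{N} C(i-1,k-1) · cc g n i, i.e. the (n,k) entry of C·L once N ≥ n;
  -- the column k = 0 of C·L is cc g · 0.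
  pascalSum : (ℕ → Carrier) → ℕ → ℕ → ℕ → Carrier
  pascalSum g N zero    n = cc g n 0
  pascalSum g N (suc k) n = sumBelow N (λ i → binomR i k * cc g n (suc i))

  pascalSum-suc-split : ∀ g N k n →
    pascalSum g (suc N) (suc k) n ≈
    binomR 0 k * cc g n 1 + sumBelow N (λ i → binomR (suc i) k * convolve g (λ p → cc g p (suc i)) n)
  pascalSum-suc-split g N k n = trans (sumBelow-suc N _)
    (+-cong refl (sumBelow-cong N (λ i _ → *-cong refl (cc-suc g n (suc i)))))

  pascalSum-suc : ∀ g N k n →
    pascalSum g (suc N) (suc k) n ≈
    convolve g (pascalSum g N k) n + convolve g (pascalSum g N (suc k)) n
  pascalSum-suc g N zero n = begin
    pascalSum g (suc N) 1 n
      ≈⟨ pascalSum-suc-split g N 0 n ⟩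
    binomR 0 0 * cc g n 1 + sumBelow N (λ i → binomR i 0 * convolve g (B (suc i)) n)
      ≈⟨ +-cong (trans (*-cong (+-identityʳ 1#) refl) (trans (*-identityˡ _) (cc-suc g n 0)))
                (sumBelow-convolve g N _ (λ i → B (suc i)) n) ⟩
    convolve g (pascalSum g N 0) n + convolve g (pascalSum g N 1) n ∎
    where
    B : ℕ → ℕ → Carrier
    B i p = cc g p i
  pascalSum-suc g N (suc k) n = begin
    pascalSum g (suc N) (suc (suc k)) n
      ≈⟨ pascalSum-suc-split g N (suc k) n ⟩
    binomR 0 (suc k) * cc g n 1 + sumBelow N (λ i → binomR (suc i) (suc k) * convolve g (B (suc i)) n)
      ≈⟨ +-cong (zeroˡ _) (sumBelow-cong N (λ i _ → trans (*-cong (binomR-pascal i k) refl) (distribʳ _ _ _))) ⟩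
    0# + sumBelow N (λ i → binomR i k * convolve g (B (suc i)) n + binomR i (suc k) * convolve g (B (suc i)) n)
      ≈⟨ trans (+-identityˡ _) (sumBelow-+ N _ _) ⟩
    sumBelow N (λ i → binomR i k * convolve g (B (suc i)) n) +
    sumBelow N (λ i → binomR i (suc k) * convolve g (B (suc i)) n)
      ≈⟨ +-cong (sumBelow-convolve g N _ (λ i → B (suc i)) n) (sumBelow-convolve g N _ (λ i → B (suc i)) n) ⟩
    convolve g (pascalSum g N (suc k)) n + convolve g (pascalSum g N (suc (suc k))) n ∎
    where
    B : ℕ → ℕ → Carrier
    B i p = cc g p i

  cc-invert≈pascalSum : ∀ g n k N → n ≤ N → cc (invert g) n k ≈ pascalSum g N k n
  cc-invert≈pascalSum g = <-rec _ step
    where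
    Claim : ℕ → Set ℓ
    Claim n = ∀ k N → n ≤ N → cc (invert g) n k ≈ pascalSum g N k n
    step : ∀ n → (∀ {p} → p < n → Claim p) → Claim n
    step zero    ih zero    N       _   = refl
    step (suc n) ih zero    N       _   = refl
    step zero    ih (suc k) zero    z≤n = cc-vanishes (invert g) zero k z≤n
    step n       ih (suc k) (suc N) n≤N = begin
      cc (invert g) n (suc k)
        ≈⟨ cc-invert-suc g n k ⟩
      convolve g (λ p → cc (invert g) p k) n + convolve g (λ p → cc (invert g) p (suc k)) n
        ≈⟨ +-cong (convolve-cong g n (λ p p<n → ih p<n k N (p≤N p<n)))
                  (convolve-cong g n (λ p p<n → ih p<n (suc k) N (p≤N p<n))) ⟩
      convolve g (pascalSum g N k) n + convolve g (pascalSum g N (suc k)) n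
        ≈⟨ sym (pascalSum-suc g N k n) ⟩
      pascalSum g (suc N) (suc k) n ∎
      where
      p≤N : ∀ {p} → p < n → p ≤ N
      p≤N p<n = ℕₚ.≤-pred (ℕₚ.≤-trans p<n n≤N)

  cc-invert≈binomial-sum : ∀ g n k → suc k ≤ n →
    cc (invert g) n (suc k) ≈ sumFromTo (suc k) n (λ i → binomR (i ∸ 1) k * cc g n i)
  cc-invert≈binomial-sum g n k k<n = begin
    cc (invert g) n (suc k)
      ≈⟨ cc-invert≈pascalSum g n (suc k) (k ℕ.+ (n ∸ k)) n≤k+[n∸k] ⟩
    sumBelow (k ℕ.+ (n ∸ k)) (λ i → binomR i k * cc g n (suc i))
      ≈⟨ sumBelow-binomR-shift k (n ∸ k) _ ⟩
    sumFromTo (suc k) n (λ i → binomR (i ∸ 1) k * cc g n i) ∎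
    where
    n≤k+[n∸k] : n ≤ k ℕ.+ (n ∸ k)
    n≤k+[n∸k] = ℕₚ.≤-reflexive (≡.sym (ℕₚ.m+[n∸m]≡n (ℕₚ.<⇒≤ k<n)))

proposition6 : {a ℓ : Level} (R : CommutativeRing a ℓ) →
    let open CommutativeRing R
        open InvertTransform R
    in (f0 : ℕ → Carrier) (m : ℕ) → 1 < m → (n k : ℕ) → 1 ≤ k → k ≤ n →
       c f0 m n k ≈ sumFromTo k n (λ i → binomR (i ∸ 1) (k ∸ 1) * c f0 (m ∸ 1) n i)
proposition6 R f0 (suc (suc m)) _ n (suc k) _ k<n =
  cc-invert≈binomial-sum R (InvertTransform.f R f0 m) n k k<n
proposition6 R f0 (suc zero) (s≤s ()) n k _ _
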